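{- Let $X$ be a graph. Then both $L(X'')$ and $\gamma(X)$ are double covers of the line graph $L(X)$.
   Context: All graphs are finite, without loops or multiple edges. $L(X)$ is the line graph of $X$. $X''$ denotes the Kronecker product $X\times K_2$: vertex set $V(X)\times\{0,1\}$, with $(x,a)$ adjacent to $(y,b)$ iff $xy\in E(X)$ and $a\neq b$. For a graph $X$ with $m$ edges, orient each edge arbitrarily and label the oriented edges $e_1,\dots,e_m$; put $e_{m+i}=e_i^{ -1}$ ($e_i$ reversed), and write $s(e),t(e)$ for starting and terminal vertices. The edge adjacency matrix $M$ is the $2m\times 2m$ matrix with $M_{ij}=1$ if $t(e_i)=s(e_j)$ and $s(e_i)\neq t(e_j)$, and $0$ otherwise; $\gamma(X)$ is the graph on vertices $e_1,\dots,e_{2m}$ with adjacency matrix $M+M^T$ (equivalently: vertices are ordered pairs $(u,v)$ with $uv\in E(X)$, and $(u,v)\sim(x,y)$ iff ($v=x$ and $y\neq u$) or ($y=u$ and $x\neq v$)). A graph $Y$ is a covering graph of $X$ if there is a map $f:V(Y)\to V(X)$ such that for every vertex $v$ of $Y$ the neighbourhood of $v$ in $Y$ is mapped bijectively onto the neighbourhood of $f(v)$ in $X$; it is a double cover if moreover every vertex of $X$ has exactly two preimages under $f$. -}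

module Defs where

open import Data.Nat using (ℕ)
open import Data.Fin using (Fin) renaming (_<_ to _<ᶠ_)
open import Data.Bool using (Bool; true; false; not)
open import Data.Product using (Σ; _×_; _,_; proj₁; proj₂)
open import Data.Sum using (_⊎_)
open import Relation.Binary.PropositionalEquality using (_≡_; _≢_)
open import Relation.Nullary using (¬_)

record SimpleGraph (n : ℕ) : Set where
  field
    adj        : Fin n → Fin n → Bool
    adj-sym    : ∀ x y → adj x y ≡ adj y x
    adj-irrefl : ∀ x → adj x x ≡ false

open SimpleGraph public

record Graph : Set₁ where
  constructor mkGraph
  field
    V   : Set
    Adj : V → V → Set

open Graph public

asGraph : ∀ {n} → SimpleGraph n → Graph
asGraph {n} X = mkGraph (Fin n) (λ x y → adj X x y ≡ true)

IsCover : (Y X : Graph) → (V Y → V X) → Set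
IsCover Y X f = ∀ v →
    (∀ w → Adj Y v w → Adj X (f v) (f w))
  × (∀ w w' → Adj Y v w → Adj Y v w' → f w ≡ f w' → w ≡ w')
  × (∀ z → Adj X (f v) z → Σ (V Y) λ w → Adj Y v w × f w ≡ z)

ExactlyTwoPreimages : {A B : Set} → (A → B) → B → Set
ExactlyTwoPreimages {A} f x =
  Σ A λ a → Σ A λ b →
    a ≢ b × f a ≡ x × f b ≡ x × (∀ c → f c ≡ x → (c ≡ a) ⊎ (c ≡ b))

IsDoubleCover : (Y X : Graph) → (V Y → V X) → Set
IsDoubleCover Y X f = IsCover Y X f × (∀ x → ExactlyTwoPreimages f x)

DoubleCoverOf : Graph → Graph → Set
DoubleCoverOf Y X = Σ (V Y → V X) (IsDoubleCover Y X)

-- Line graph of G, relative to a strict total order _≺_ on V G used only to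
-- pick a canonical representative (u , v) with u ≺ v of each unordered edge {u,v}.
lineGraphBy : (G : Graph) → (V G → V G → Set) → Graph
lineGraphBy G _≺_ = mkGraph
  (Σ (V G × V G) λ p → (proj₁ p ≺ proj₂ p) × Adj G (proj₁ p) (proj₂ p))
  (λ e f → let u = proj₁ (proj₁ e) ; v = proj₂ (proj₁ e)
               x = proj₁ (proj₁ f) ; y = proj₂ (proj₁ f)
           in ¬ (u ≡ x × v ≡ y) × ((u ≡ x) ⊎ (u ≡ y) ⊎ (v ≡ x) ⊎ (v ≡ y)))

L : ∀ {n} → SimpleGraph n → Graph
L X = lineGraphBy (asGraph X) _<ᶠ_

-- Kronecker product X'' = X × K₂ on Fin n × Bool:
-- (x,a) ~ (y,b) iff xy ∈ E(X) and a ≠ b (written b ≡ not a).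
kron : ∀ {n} → SimpleGraph n → Graph
kron {n} X = mkGraph (Fin n × Bool)
  (λ p q → (adj X (proj₁ p) (proj₁ q) ≡ true) × (proj₂ q ≡ not (proj₂ p)))

_≺lex_ : ∀ {n} → Fin n × Bool → Fin n × Bool → Set
p ≺lex q = (proj₁ p <ᶠ proj₁ q)
         ⊎ ((proj₁ p ≡ proj₁ q) × (proj₂ p ≡ false) × (proj₂ q ≡ true))

L'' : ∀ {n} → SimpleGraph n → Graph
L'' X = lineGraphBy (kron X) _≺lex_

γ : ∀ {n} → SimpleGraph n → Graph
γ {n} X = mkGraph
  (Σ (Fin n × Fin n) λ p → adj X (proj₁ p) (proj₂ p) ≡ true)
  (λ e f → let u = proj₁ (proj₁ e) ; v = proj₂ (proj₁ e)
               x = proj₁ (proj₁ f) ; y = proj₂ (proj₁ f)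
           in ((v ≡ x) × (y ≢ u)) ⊎ ((y ≡ u) × (x ≢ v)))

-- Both covering maps are forgetful. L(X'') → L(X) drops the K₂-coordinate: an edge uv of X
-- lifts to exactly the two edges {(u,0),(v,1)} and {(u,1),(v,0)} of X'', and a lift of an edge
-- meeting uv is pinned down by agreeing with the given lift at the common endpoint. γ(X) → L(X)
-- drops the orientation: uv has the two orientations (u,v), (v,u), and the γ-neighbours of (u,v)
-- are the oriented edges leaving v or entering u, exactly one for each edge of X meeting uv.
module Submission where

open import Defs
open import Data.Nat using (ℕ)
open import Data.Product using (_×_; Σ; _,_; proj₁; proj₂)
open import Data.Sum using (_⊎_; inj₁; inj₂)
open import Data.Bool using (Bool; true; false; not) renaming (_≟_ to _≟ᵇ_)
open import Data.Bool.Properties using (not-injective; not-involutive)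
open import Data.Fin using (Fin) renaming (_<_ to _<ᶠ_)
open import Data.Fin.Properties using (<-irrelevant; <-cmp; <-asym)
open import Data.Empty using (⊥-elim)
open import Function using (_∘_)
open import Relation.Nullary using (¬_)
open import Relation.Binary.Definitions using (tri<; tri≈; tri>)
open import Relation.Binary.PropositionalEquality
open import Axiom.UniquenessOfIdentityProofs using (module Decidable⇒UIP)

module UnorderedPairs {a} {A : Set a} where

  infix 4 _≐_

  _≐_ : A × A → A × A → Set a
  (u , v) ≐ (x , y) = (u ≡ x × v ≡ y) ⊎ (u ≡ y × v ≡ x)

  Meet : A × A → A × A → Set a
  Meet (u , v) (x , y) = u ≡ x ⊎ u ≡ y ⊎ v ≡ x ⊎ v ≡ y

  ≐-refl : ∀ {p} → p ≐ p
  ≐-refl = inj₁ (refl , refl)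

  ≡⇒≐ : ∀ {p q} → p ≡ q → p ≐ q
  ≡⇒≐ refl = ≐-refl

  ≐-swap : ∀ {u v} → (u , v) ≐ (v , u)
  ≐-swap = inj₂ (refl , refl)

  ≐-sym : ∀ {p q} → p ≐ q → q ≐ p
  ≐-sym (inj₁ (e₁ , e₂)) = inj₁ (sym e₁ , sym e₂)
  ≐-sym (inj₂ (e₁ , e₂)) = inj₂ (sym e₂ , sym e₁)

  ≐-trans : ∀ {p q r} → p ≐ q → q ≐ r → p ≐ r
  ≐-trans (inj₁ (e₁ , e₂)) (inj₁ (d₁ , d₂)) = inj₁ (trans e₁ d₁ , trans e₂ d₂)
  ≐-trans (inj₁ (e₁ , e₂)) (inj₂ (d₁ , d₂)) = inj₂ (trans e₁ d₁ , trans e₂ d₂)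
  ≐-trans (inj₂ (e₁ , e₂)) (inj₁ (d₁ , d₂)) = inj₂ (trans e₁ d₂ , trans e₂ d₁)
  ≐-trans (inj₂ (e₁ , e₂)) (inj₂ (d₁ , d₂)) = inj₁ (trans e₁ d₂ , trans e₂ d₁)

  Meet-swapˡ : ∀ {u v q} → Meet (u , v) q → Meet (v , u) q
  Meet-swapˡ (inj₁ e)                = inj₂ (inj₂ (inj₁ e))
  Meet-swapˡ (inj₂ (inj₁ e))         = inj₂ (inj₂ (inj₂ e))
  Meet-swapˡ (inj₂ (inj₂ (inj₁ e)))  = inj₁ e
  Meet-swapˡ (inj₂ (inj₂ (inj₂ e)))  = inj₂ (inj₁ e)

  Meet-sym : ∀ {p q} → Meet p q → Meet q p
  Meet-sym (inj₁ e)                = inj₁ (sym e)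
  Meet-sym (inj₂ (inj₁ e))         = inj₂ (inj₂ (inj₁ (sym e)))
  Meet-sym (inj₂ (inj₂ (inj₁ e)))  = inj₂ (inj₁ (sym e))
  Meet-sym (inj₂ (inj₂ (inj₂ e)))  = inj₂ (inj₂ (inj₂ (sym e)))

  Meet-respˡ-≐ : ∀ {p p' q} → p ≐ p' → Meet p q → Meet p' q
  Meet-respˡ-≐ (inj₁ (refl , refl)) m = m
  Meet-respˡ-≐ (inj₂ (refl , refl)) m = Meet-swapˡ m

  Meet-resp-≐ : ∀ {p p' q q'} → p ≐ p' → q ≐ q' → Meet p q → Meet p' q'
  Meet-resp-≐ p≐p' q≐q' m = Meet-respˡ-≐ p≐p' (Meet-sym (Meet-respˡ-≐ q≐q' (Meet-sym m)))

  ¬aligned×crossed : ∀ {u v x y : A} → u ≢ v → x ≢ y → (u ≡ x ⊎ v ≡ y) → ¬ (u ≡ y ⊎ v ≡ x)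
  ¬aligned×crossed u≢v x≢y (inj₁ refl) (inj₁ refl) = x≢y refl
  ¬aligned×crossed u≢v x≢y (inj₁ refl) (inj₂ refl) = u≢v refl
  ¬aligned×crossed u≢v x≢y (inj₂ refl) (inj₁ refl) = u≢v refl
  ¬aligned×crossed u≢v x≢y (inj₂ refl) (inj₂ refl) = x≢y refl

open UnorderedPairs

module _ {a} {A : Set a} where

  -- The edges {(u,b),(v,¬b)} and {(x,b'),(y,¬b')} of X'' share an endpoint.
  BitMeet : A → A → Bool → A → A → Bool → Set a
  BitMeet u v b x y b' = (b ≡ b' × (u ≡ x ⊎ v ≡ y)) ⊎ (b ≡ not b' × (u ≡ y ⊎ v ≡ x))

  Meet⇒BitMeet : ∀ {u v x y : A} {b c b' c'} → c ≡ not b → c' ≡ not b' →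
                 Meet ((u , b) , (v , c)) ((x , b') , (y , c')) → BitMeet u v b x y b'
  Meet⇒BitMeet _    _    (inj₁ refl)                = inj₁ (refl , inj₁ refl)
  Meet⇒BitMeet _    refl (inj₂ (inj₁ refl))         = inj₂ (refl , inj₁ refl)
  Meet⇒BitMeet refl _    (inj₂ (inj₂ (inj₁ refl)))  = inj₂ (sym (not-involutive _) , inj₂ refl)
  Meet⇒BitMeet refl refl (inj₂ (inj₂ (inj₂ e)))     = inj₁ (not-injective (cong proj₂ e) , inj₂ (cong proj₁ e))

  BitMeet⇒Meet : ∀ {u v x y : A} {b b'} → BitMeet u v b x y b' → Meet (u , v) (x , y)
  BitMeet⇒Meet (inj₁ (_ , inj₁ u≡x)) = inj₁ u≡x
  BitMeet⇒Meet (inj₁ (_ , inj₂ v≡y)) = inj₂ (inj₂ (inj₂ v≡y))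
  BitMeet⇒Meet (inj₂ (_ , inj₁ u≡y)) = inj₂ (inj₁ u≡y)
  BitMeet⇒Meet (inj₂ (_ , inj₂ v≡x)) = inj₂ (inj₂ (inj₁ v≡x))

  BitMeet-functional : ∀ {u v x y : A} {b b₁ b₂} → u ≢ v → x ≢ y →
                       BitMeet u v b x y b₁ → BitMeet u v b x y b₂ → b₁ ≡ b₂
  BitMeet-functional _   _   (inj₁ (refl , _)) (inj₁ (refl , _)) = refl
  BitMeet-functional u≢v x≢y (inj₁ (_ , p))    (inj₂ (_ , q))    = ⊥-elim (¬aligned×crossed u≢v x≢y p q)
  BitMeet-functional u≢v x≢y (inj₂ (_ , q))    (inj₁ (_ , p))    = ⊥-elim (¬aligned×crossed u≢v x≢y p q)
  BitMeet-functional _   _   (inj₂ (e₁ , _))   (inj₂ (e₂ , _))   = not-injective (trans (sym e₁) e₂)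

module _ {n : ℕ} (X : SimpleGraph n) where

  Edge : Fin n → Fin n → Set
  Edge u v = adj X u v ≡ true

  edge⇒≢ : ∀ {u v} → Edge u v → u ≢ v
  edge⇒≢ {u} uv refl with () ← trans (sym uv) (adj-irrefl X u)

  edge-sym : ∀ {u v} → Edge u v → Edge v u
  edge-sym {u} {v} uv = trans (adj-sym X v u) uv

  edge-irrelevant : ∀ {u v} (e e' : Edge u v) → e ≡ e'
  edge-irrelevant = Decidable⇒UIP.≡-irrelevant _≟ᵇ_

  LVertex : Set
  LVertex = V (L X)

  line-≡ : ∀ {u v x y} {l : u <ᶠ v} {e : Edge u v} {l' : x <ᶠ y} {e' : Edge x y} →
           u ≡ x → v ≡ y → _≡_ {A = LVertex} ((u , v) , l , e) ((x , y) , l' , e')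
  line-≡ {l = l} {e} {l'} {e'} refl refl =
    cong₂ (λ l e → (_ , l , e)) (<-irrelevant l l') (edge-irrelevant e e')

  ordered-≐ : ∀ {u v x y : Fin n} → u <ᶠ v → x <ᶠ y → (u , v) ≐ (x , y) → u ≡ x × v ≡ y
  ordered-≐ _   _   (inj₁ eqs)          = eqs
  ordered-≐ u<v y<x (inj₂ (refl , refl)) = ⊥-elim (<-asym u<v y<x)

  ≐⇒≡ : (e e' : LVertex) → proj₁ e ≐ proj₁ e' → e ≡ e'
  ≐⇒≡ (_ , l , _) (_ , l' , _) e≐e' = let u≡x , v≡y = ordered-≐ l l' e≐e' in line-≡ u≡x v≡y

  lineVertex : ∀ u v → Edge u v → LVertex
  lineVertex u v uv with <-cmp u v
  ... | tri< u<v _ _ = (u , v) , u<v , uv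
  ... | tri≈ _ u≡v _ = ⊥-elim (edge⇒≢ uv u≡v)
  ... | tri> _ _ v<u = (v , u) , v<u , edge-sym uv

  lineVertex-≐ : ∀ u v (uv : Edge u v) → proj₁ (lineVertex u v uv) ≐ (u , v)
  lineVertex-≐ u v uv with <-cmp u v
  ... | tri< _ _ _   = ≐-refl
  ... | tri≈ _ u≡v _ = ⊥-elim (edge⇒≢ uv u≡v)
  ... | tri> _ _ _   = ≐-swap

  lineVertex-≡ : ∀ u v (uv : Edge u v) (e : LVertex) → (u , v) ≐ proj₁ e → lineVertex u v uv ≡ e
  lineVertex-≡ u v uv e uv≐e = ≐⇒≡ (lineVertex u v uv) e (≐-trans (lineVertex-≐ u v uv) uv≐e)

  line-adj : (e e' : LVertex) {p q : Fin n × Fin n} → proj₁ e ≐ p → proj₁ e' ≐ q →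
             ¬ p ≐ q → Meet p q → Adj (L X) e e'
  line-adj e e' e≐p e'≐q p≉q m =
      (λ eqs → p≉q (≐-trans (≐-sym e≐p) (≐-trans (inj₁ eqs) e'≐q)))
    , Meet-resp-≐ (≐-sym e≐p) (≐-sym e'≐q) m

  line-adj⁻¹ : (e e' : LVertex) {p q : Fin n × Fin n} → proj₁ e ≐ p → proj₁ e' ≐ q →
               Adj (L X) e e' → ¬ p ≐ q × Meet p q
  line-adj⁻¹ (_ , l , _) (_ , l' , _) e≐p e'≐q (e≢e' , m) =
      (λ p≐q → e≢e' (ordered-≐ l l' (≐-trans e≐p (≐-trans p≐q (≐-sym e'≐q)))))
    , Meet-resp-≐ e≐p e'≐q m

  γVertex : Set
  γVertex = V (γ X)

  γ-≡ : ∀ {u v x y} {e : Edge u v} {e' : Edge x y} →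
        u ≡ x → v ≡ y → _≡_ {A = γVertex} ((u , v) , e) ((x , y) , e')
  γ-≡ {e = e} {e'} refl refl = cong (_ ,_) (edge-irrelevant e e')

  γ-neighbours-≐⇒≡ : ∀ a w w' → Adj (γ X) a w → Adj (γ X) a w' → proj₁ w ≐ proj₁ w' → w ≡ w'
  γ-neighbours-≐⇒≡ _ _ _ _ _ (inj₁ (refl , refl)) = γ-≡ refl refl
  γ-neighbours-≐⇒≡ _ (_ , vy) _ (inj₁ (refl , _)) (inj₁ (refl , _)) (inj₂ (_ , y≡v)) =
    ⊥-elim (edge⇒≢ vy (sym y≡v))
  γ-neighbours-≐⇒≡ (_ , uv) _ _ (inj₁ (refl , _)) (inj₂ (refl , _)) (inj₂ (v≡u , _)) =
    ⊥-elim (edge⇒≢ uv (sym v≡u))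
  γ-neighbours-≐⇒≡ (_ , uv) _ _ (inj₂ (refl , _)) (inj₁ (refl , _)) (inj₂ (_ , u≡v)) =
    ⊥-elim (edge⇒≢ uv u≡v)
  γ-neighbours-≐⇒≡ _ (_ , xu) _ (inj₂ (refl , _)) (inj₂ (refl , _)) (inj₂ (x≡u , _)) =
    ⊥-elim (edge⇒≢ xu x≡u)

  unorient : γVertex → LVertex
  unorient ((u , v) , uv) = lineVertex u v uv

  unorient-≐ : (w : γVertex) → proj₁ (unorient w) ≐ proj₁ w
  unorient-≐ ((u , v) , uv) = lineVertex-≐ u v uv

  unorient-≡⇒≐ : (w w' : γVertex) → unorient w ≡ unorient w' → proj₁ w ≐ proj₁ w'
  unorient-≡⇒≐ w w' eq = ≐-trans (≐-sym (unorient-≐ w)) (≐-trans (≡⇒≐ (cong proj₁ eq)) (unorient-≐ w'))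

  unorient-cover : IsCover (γ X) (L X) unorient
  unorient-cover a@((u , v) , uv) = preserves , injective , surjective
    where
    preserves : ∀ w → Adj (γ X) a w → Adj (L X) (unorient a) (unorient w)
    preserves w@((_ , y) , _) (inj₁ (refl , y≢u)) =
      line-adj (unorient a) (unorient w) (unorient-≐ a) (unorient-≐ w) uv≉vy (inj₂ (inj₂ (inj₁ refl)))
      where
      uv≉vy : ¬ (u , v) ≐ (v , y)
      uv≉vy (inj₁ (u≡v , _)) = edge⇒≢ uv u≡v
      uv≉vy (inj₂ (u≡y , _)) = y≢u (sym u≡y)
    preserves w@((x , _) , _) (inj₂ (refl , x≢v)) =
      line-adj (unorient a) (unorient w) (unorient-≐ a) (unorient-≐ w) uv≉xu (inj₂ (inj₁ refl))
      where
      uv≉xu : ¬ (u , v) ≐ (x , u)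
      uv≉xu (inj₁ (_ , v≡u)) = edge⇒≢ uv (sym v≡u)
      uv≉xu (inj₂ (_ , v≡x)) = x≢v (sym v≡x)

    injective : ∀ w w' → Adj (γ X) a w → Adj (γ X) a w' → unorient w ≡ unorient w' → w ≡ w'
    injective w w' aw aw' eq = γ-neighbours-≐⇒≡ a w w' aw aw' (unorient-≡⇒≐ w w' eq)

    surjective : ∀ z → Adj (L X) (unorient a) z → Σ γVertex λ w → Adj (γ X) a w × unorient w ≡ z
    surjective z@((p , q) , _ , pq) az with line-adj⁻¹ (unorient a) z (unorient-≐ a) ≐-refl az
    ... | uv≉pq , inj₁ refl =
      ((q , u) , edge-sym pq) , inj₂ (refl , λ q≡v → uv≉pq (inj₁ (refl , sym q≡v))) ,
      lineVertex-≡ q u _ z ≐-swap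
    ... | uv≉pq , inj₂ (inj₁ refl) =
      ((p , u) , pq) , inj₂ (refl , λ p≡v → uv≉pq (inj₂ (refl , sym p≡v))) ,
      lineVertex-≡ p u _ z ≐-refl
    ... | uv≉pq , inj₂ (inj₂ (inj₁ refl)) =
      ((v , q) , pq) , inj₁ (refl , λ q≡u → uv≉pq (inj₂ (sym q≡u , refl))) ,
      lineVertex-≡ v q _ z ≐-refl
    ... | uv≉pq , inj₂ (inj₂ (inj₂ refl)) =
      ((v , p) , edge-sym pq) , inj₁ (refl , λ p≡u → uv≉pq (inj₁ (sym p≡u , refl))) ,
      lineVertex-≡ v p _ z ≐-swap

  unorient-two-preimages : ∀ z → ExactlyTwoPreimages unorient z
  unorient-two-preimages z@((p , q) , _ , pq) =
    forward , backward , forward≢backward ,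
    lineVertex-≡ p q pq z ≐-refl , lineVertex-≡ q p _ z ≐-swap , only
    where
    forward backward : γVertex
    forward  = (p , q) , pq
    backward = (q , p) , edge-sym pq

    forward≢backward : forward ≢ backward
    forward≢backward = edge⇒≢ pq ∘ cong (proj₁ ∘ proj₁)

    only : ∀ w → unorient w ≡ z → w ≡ forward ⊎ w ≡ backward
    only w eq with ≐-trans (≐-sym (unorient-≐ w)) (≡⇒≐ (cong proj₁ eq))
    ... | inj₁ (x≡p , y≡q) = inj₁ (γ-≡ x≡p y≡q)
    ... | inj₂ (x≡q , y≡p) = inj₂ (γ-≡ x≡q y≡p)

  L''Vertex : Set
  L''Vertex = V (L'' X)

  ≺lex-edge⇒< : ∀ {u v b c} → (u , b) ≺lex (v , c) → Edge u v → u <ᶠ v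
  ≺lex-edge⇒< (inj₁ u<v)       _  = u<v
  ≺lex-edge⇒< (inj₂ (u≡v , _)) uv = ⊥-elim (edge⇒≢ uv u≡v)

  ≺lex-irrelevant-on-edges : ∀ {u v b c} → Edge u v → (l l' : (u , b) ≺lex (v , c)) → l ≡ l'
  ≺lex-irrelevant-on-edges _  (inj₁ l)         (inj₁ l')        = cong inj₁ (<-irrelevant l l')
  ≺lex-irrelevant-on-edges uv (inj₁ _)         (inj₂ (u≡v , _)) = ⊥-elim (edge⇒≢ uv u≡v)
  ≺lex-irrelevant-on-edges uv (inj₂ (u≡v , _)) _                = ⊥-elim (edge⇒≢ uv u≡v)

  L''-≡ : ∀ {u v b c x y b' c'} {l : (u , b) ≺lex (v , c)} {uv : Edge u v} {c≡¬b : c ≡ not b}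
            {l' : (x , b') ≺lex (y , c')} {xy : Edge x y} {c'≡¬b' : c' ≡ not b'} →
          u ≡ x → v ≡ y → b ≡ b' →
          _≡_ {A = L''Vertex} (((u , b) , (v , c)) , l , uv , c≡¬b) (((x , b') , (y , c')) , l' , xy , c'≡¬b')
  L''-≡ {l = l} {uv} {refl} {l'} {xy} {refl} refl refl refl =
    cong₂ (λ l e → (_ , l , e , refl)) (≺lex-irrelevant-on-edges uv l l') (edge-irrelevant uv xy)

  forgetBits : L''Vertex → LVertex
  forgetBits (((u , _) , (v , _)) , l , uv , _) = (u , v) , ≺lex-edge⇒< l uv , uv

  withBit : LVertex → Bool → L''Vertex
  withBit ((u , v) , u<v , uv) b = ((u , b) , (v , not b)) , inj₁ u<v , uv , refl

  forgetBits-cover : IsCover (L'' X) (L X) forgetBits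
  forgetBits-cover e@(((u , b) , (v , c)) , l , uv , c≡¬b) = preserves , injective , surjective
    where
    preserves : ∀ w → Adj (L'' X) e w → Adj (L X) (forgetBits e) (forgetBits w)
    preserves w@(((x , b') , (y , _)) , l' , xy , c'≡¬b') (e≢w , m) =
      line-adj (forgetBits e) (forgetBits w) ≐-refl ≐-refl uv≉xy (BitMeet⇒Meet bits)
      where
      bits : BitMeet u v b x y b'
      bits = Meet⇒BitMeet c≡¬b c'≡¬b' m

      uv≉xy : ¬ (u , v) ≐ (x , y)
      uv≉xy uv≐xy with ordered-≐ (≺lex-edge⇒< l uv) (≺lex-edge⇒< l' xy) uv≐xy | bits
      ... | refl , refl | inj₁ (refl , _)     = e≢w (refl , cong (v ,_) (trans c≡¬b (sym c'≡¬b')))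
      ... | refl , refl | inj₂ (_ , crossed)  = ¬aligned×crossed (edge⇒≢ uv) (edge⇒≢ xy) (inj₁ refl) crossed

    injective : ∀ w w' → Adj (L'' X) e w → Adj (L'' X) e w' → forgetBits w ≡ forgetBits w' → w ≡ w'
    injective (_ , _ , xy , c₁≡¬b₁) (_ , _ , _ , c₂≡¬b₂) (_ , m₁) (_ , m₂) eq
      with cong (proj₁ ∘ proj₁) eq | cong (proj₂ ∘ proj₁) eq
    ... | refl | refl = L''-≡ refl refl
      (BitMeet-functional (edge⇒≢ uv) (edge⇒≢ xy)
        (Meet⇒BitMeet c≡¬b c₁≡¬b₁ m₁) (Meet⇒BitMeet c≡¬b c₂≡¬b₂ m₂))

    surjective : ∀ z → Adj (L X) (forgetBits e) z → Σ L''Vertex λ w → Adj (L'' X) e w × forgetBits w ≡ z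
    surjective z@((x , y) , _) (uv≢xy , m) = lift m
      where
      adjacent-lift : ∀ {b'} → Meet ((u , b) , (v , c)) ((x , b') , (y , not b')) →
                      Adj (L'' X) e (withBit z b')
      adjacent-lift m' = (λ (p , q) → uv≢xy (cong proj₁ p , cong proj₁ q)) , m'

      lift : Meet (u , v) (x , y) → Σ L''Vertex λ w → Adj (L'' X) e w × forgetBits w ≡ z
      lift (inj₁ refl)               = withBit z b , adjacent-lift (inj₁ refl) , refl
      lift (inj₂ (inj₁ refl))        =
        withBit z (not b) , adjacent-lift (inj₂ (inj₁ (cong (u ,_) (sym (not-involutive b))))) , refl
      lift (inj₂ (inj₂ (inj₁ refl))) = withBit z c , adjacent-lift (inj₂ (inj₂ (inj₁ refl))) , refl
      lift (inj₂ (inj₂ (inj₂ refl))) = withBit z b , adjacent-lift (inj₂ (inj₂ (inj₂ (cong (v ,_) c≡¬b)))) , refl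

  forgetBits-two-preimages : ∀ z → ExactlyTwoPreimages forgetBits z
  forgetBits-two-preimages z =
    withBit z false , withBit z true , (λ ()) ∘ cong (proj₂ ∘ proj₁ ∘ proj₁) , refl , refl , only
    where
    only : ∀ w → forgetBits w ≡ z → w ≡ withBit z false ⊎ w ≡ withBit z true
    only (((_ , false) , _) , _) refl = inj₁ (L''-≡ refl refl refl)
    only (((_ , true)  , _) , _) refl = inj₂ (L''-≡ refl refl refl)

mainTheorem7 : ∀ {n : ℕ} (X : SimpleGraph n) →
    DoubleCoverOf (L'' X) (L X) × DoubleCoverOf (γ X) (L X)
mainTheorem7 X = (forgetBits X , forgetBits-cover X , forgetBits-two-preimages X)
               , (unorient X , unorient-cover X , unorient-two-preimages X)
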